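{- Let $\mathfrak A$ be a multistructure with domain $(A,n)$, let $X$ be a team with codomain $A$, and let $\vec x,\vec y,\vec z$ be tuples of variables such that $\mathrm{Var}(\vec x\vec y\vec z)=\mathrm{Dom}(X)$. Let $1$ denote the constant function mapping every assignment of $X$ to $1$. Then $\mathfrak A\models_{(X,1)}\vec y\perp\!\!\!\perp_{\vec x}\vec z$ if and only if $\mathfrak A\models_{(X,1)}\vec y\perp_{\vec x}\vec z$.
   Context: A multiset is a pair $(A,m)$ with $m:A\to\mathbb N$; $|(A,m)|=\sum_{a\in A}m(a)$. An assignment is a function from a finite set of variables to a set $A$; a team is a finite set of assignments with common domain $\mathrm{Dom}(X)$ and common codomain; a multiteam is a multiset $(X,m)$ with $X$ a team. A multistructure has as domain a finite multiset $(A,n)$ (plus relations). For an assignment $s$ and tuple $\vec x=(x_1,\dots,x_k)$, $s(\vec x)=(s(x_1),\dots,s(x_k))$; $\mathrm{Var}(\vec x)$ is the set of variables in $\vec x$; $\vec x\vec y$ is concatenation. For $\vec a\in A^{|\vec x|}$, $(X,m)_{\vec x=\vec a}$ is $(X,m')$ with $m'(s)=m(s)$ if $s(\vec x)=\vec a$ and $0$ otherwise. Probabilistic conditional independence atom: $\mathfrak A\models_{(X,m)}\vec y\perp\!\!\!\perp_{\vec x}\vec z$ iff for all $s:\mathrm{Var}(\vec x\vec y\vec z)\to A$, $|(X,m)_{\vec x\vec y=s(\vec x\vec y)}|\cdot|(X,m)_{\vec x\vec z=s(\vec x\vec z)}|=|(X,m)_{\vec x\vec y\vec z=s(\vec x\vec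 y\vec z)}|\cdot|(X,m)_{\vec x=s(\vec x)}|$. Conditional independence atom: $\mathfrak A\models_{(X,m)}\vec y\perp_{\vec x}\vec z$ iff, letting $X^+=\{s\in X:m(s)\ge1\}$, for all $s,s'\in X^+$ with $s(\vec x)=s'(\vec x)$ there is $s''\in X^+$ with $s''(\vec x)=s(\vec x)$, $s''(\vec y)=s(\vec y)$ and $s''(\vec z)=s'(\vec z)$. -}

module Defs where

open import Data.Nat using (ℕ; zero; suc; _+_; _*_; _≥_)
open import Data.Fin using (Fin)
open import Data.Fin.Properties using () renaming (_≟_ to _≟ᶠ_)
open import Data.Vec using (Vec; lookup)
open import Data.List using (List; []; _∷_; map; _++_)
open import Data.List.Properties using (≡-dec)
open import Data.List.Membership.Propositional using (_∈_)
open import Data.List.Relation.Unary.Unique.Propositional using (Unique)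
open import Data.Product using (Σ; _×_; ∃-syntax; _,_)
open import Relation.Nullary using (yes; no)
open import Relation.Binary.PropositionalEquality using (_≡_)

-- A multistructure with domain the finite multiset (A , n), where the
-- underlying set A is represented as Fin size.  (Its relations play no role
-- in the atoms considered here, so only the domain is recorded.)
record MultiStructure : Set where
  field
    size : ℕ
    mult : Fin size → ℕ

Carrier : MultiStructure → Set
Carrier 𝔄 = Fin (MultiStructure.size 𝔄)

-- Variables of the common domain Dom(X) are Fin k.
-- An assignment s : Dom(X) → A is represented by the vector of its values.
Assignment : ℕ → Set → Set
Assignment k A = Vec A k

Tuple : ℕ → Set
Tuple k = List (Fin k)

_⟦_⟧ : ∀ {k} {A : Set} → Assignment k A → Tuple k → List A
s ⟦ xs ⟧ = map (lookup s) xs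

-- A team: a finite set of assignments (no repetitions) with domain Fin k
-- and codomain A.
record Team (k : ℕ) (A : Set) : Set where
  constructor team
  field
    elems  : List (Assignment k A)
    unique : Unique elems

-- |(X,m)_{x⃗ = a⃗}| = Σ_{s ∈ X, s(x⃗) = a⃗} m(s)
restrictSize : ∀ {k N} → List (Assignment k (Fin N)) → (Assignment k (Fin N) → ℕ)
             → Tuple k → List (Fin N) → ℕ
restrictSize [] m xs a = 0
restrictSize (s ∷ ss) m xs a with ≡-dec _≟ᶠ_ (s ⟦ xs ⟧) a
... | yes _ = m s + restrictSize ss m xs a
... | no  _ = restrictSize ss m xs a

one : ∀ {k} {A : Set} → Assignment k A → ℕ
one _ = 1

PCondIndep : (𝔄 : MultiStructure) {k : ℕ} → Team k (Carrier 𝔄)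
           → (Assignment k (Carrier 𝔄) → ℕ) → Tuple k → Tuple k → Tuple k → Set
PCondIndep 𝔄 X m xs ys zs =
  (s : Assignment _ (Carrier 𝔄)) →
    restrictSize L m (xs ++ ys) (s ⟦ xs ++ ys ⟧)
      * restrictSize L m (xs ++ zs) (s ⟦ xs ++ zs ⟧)
    ≡ restrictSize L m (xs ++ ys ++ zs) (s ⟦ xs ++ ys ++ zs ⟧)
      * restrictSize L m xs (s ⟦ xs ⟧)
  where L = Team.elems X

_∈⁺_ : ∀ {k} {A : Set} → Assignment k A → Team k A × (Assignment k A → ℕ) → Set
s ∈⁺ (X , m) = s ∈ Team.elems X × m s ≥ 1

CondIndep : (𝔄 : MultiStructure) {k : ℕ} → Team k (Carrier 𝔄)
          → (Assignment k (Carrier 𝔄) → ℕ) → Tuple k → Tuple k → Tuple k → Set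
CondIndep 𝔄 X m xs ys zs =
  ∀ s s' → s ∈⁺ (X , m) → s' ∈⁺ (X , m) → s ⟦ xs ⟧ ≡ s' ⟦ xs ⟧ →
    ∃[ s'' ] (s'' ∈⁺ (X , m) × s'' ⟦ xs ⟧ ≡ s ⟦ xs ⟧
              × s'' ⟦ ys ⟧ ≡ s ⟦ ys ⟧ × s'' ⟦ zs ⟧ ≡ s' ⟦ zs ⟧)

module Submission where

-- With multiplicity 1 the multiteam is the set X, and |X_{v⃗ = t(v⃗)}| is
-- size(v⃗, t), the number of s ∈ X agreeing with t on v⃗.  As x⃗ y⃗ z⃗ cover
-- the domain, members of X are determined by their x⃗ y⃗ z⃗-values, so
-- size(x⃗y⃗z⃗, e) = 1 for e ∈ X.  Both directions are double counting inside
-- an x⃗-fibre, via a general lemma: if each element of S has exactly one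
-- partner in T and all fibres have size c, then |S| = |T| · c.
--  * ⊥ ⇒ ⫫ : all y⃗-rows of a fibre have equal size, and s ↦ (its partner
--    in the x⃗z⃗-class of e with the y⃗-values of s) gives
--    size(x⃗, e) = size(x⃗z⃗, e) · size(x⃗y⃗, e); empty x⃗y⃗z⃗-classes force an
--    empty x⃗y⃗- or x⃗z⃗-class.
--  * ⫫ ⇒ ⊥ : at the merge of u, v compatible on the variables shared by y⃗
--    and z⃗, the ⫫ equation yields a member of X; the same double counting
--    shows all members of an x⃗-fibre are compatible.

open import Defs
open import Data.Bool using (if_then_else_)
open import Data.Nat using (ℕ; suc; _+_; _*_; _≤_; z≤n; s≤s; >-nonZero)
open import Data.Nat.Properties
open import Data.Fin using (Fin)
open import Data.Fin.Properties using () renaming (_≟_ to _≟ᶠ_)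
open import Data.List using (List; []; _∷_; filter; _++_)
open import Data.List.Properties using (≡-dec; ∷-injective)
open import Data.List.Relation.Unary.Any using (here; there)
open import Data.List.Relation.Unary.All using () renaming (lookup to All-lookup)
open import Data.List.Relation.Unary.AllPairs using (_∷_)
open import Data.List.Relation.Unary.Unique.Propositional using (Unique)
open import Data.List.Membership.Propositional using (_∈_)
open import Data.List.Membership.Propositional.Properties
  using (∈-++⁺ˡ; ∈-++⁺ʳ; ∈-++⁻; ∈-filter⁺; ∈-filter⁻)
import Data.List.Membership.DecPropositional as DecMembership
open import Data.Vec using (Vec; lookup; tabulate)
open import Data.Vec.Properties using (lookup∘tabulate; tabulate∘lookup; tabulate-cong)
open import Data.Product using (_×_; _,_; proj₁; proj₂; ∃-syntax)
open import Data.Sum using (_⊎_; inj₁; inj₂; [_,_])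
open import Data.Empty using (⊥-elim)
open import Relation.Nullary using (Dec; yes; no; ¬_; does)
open import Relation.Nullary.Decidable using (map′; _×-dec_)
open import Relation.Unary using (Decidable)
open import Relation.Binary.PropositionalEquality
  using (_≡_; refl; sym; trans; cong; cong₂; subst; module ≡-Reasoning)
open import Function using (_∘_)
open import Function.Bundles using (_⇔_; mk⇔; Equivalence)
open import Algebra.Properties.CommutativeSemigroup +-commutativeSemigroup
  using () renaming (interchange to +-interchange)

-- Counting the elements of a list

module Counting {A : Set} where

  sumOver : List A → (A → ℕ) → ℕ
  sumOver []      f = 0
  sumOver (t ∷ T) f = f t + sumOver T f

  indicator : {P : Set} → Dec P → ℕ
  indicator (yes _) = 1
  indicator (no  _) = 0

  count : {P : A → Set} → Decidable P → List A → ℕ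
  count P? T = sumOver T (λ t → indicator (P? t))

  sumOver-+ : (T : List A) (f g : A → ℕ) →
              sumOver T (λ t → f t + g t) ≡ sumOver T f + sumOver T g
  sumOver-+ []      f g = refl
  sumOver-+ (t ∷ T) f g =
    trans (cong (f t + g t +_) (sumOver-+ T f g)) (+-interchange (f t) (g t) _ _)

  sumOver-indicator : {P : A → Set} (P? : Decidable P) (T : List A) (f : A → ℕ) (c : ℕ) →
                      (∀ {t} → t ∈ T → P t → f t ≡ c) → (∀ {t} → t ∈ T → ¬ P t → f t ≡ 0) →
                      sumOver T f ≡ count P? T * c
  sumOver-indicator P? []      f c on off = refl
  sumOver-indicator P? (t ∷ T) f c on off with P? t
  ... | yes p = cong₂ _+_ (on (here refl) p) rest
    where rest = sumOver-indicator P? T f c (on ∘ there) (off ∘ there)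
  ... | no ¬p = cong₂ _+_ (off (here refl) ¬p) rest
    where rest = sumOver-indicator P? T f c (on ∘ there) (off ∘ there)

  count-mono : {P Q : A → Set} (P? : Decidable P) (Q? : Decidable Q) (T : List A) →
               (∀ {t} → t ∈ T → P t → Q t) → count P? T ≤ count Q? T
  count-mono P? Q? []      sub = z≤n
  count-mono P? Q? (t ∷ T) sub = +-mono-≤ (head (P? t) (Q? t) (sub (here refl)))
                                          (count-mono P? Q? T (sub ∘ there))
    where
    head : {P Q : Set} (p : Dec P) (q : Dec Q) → (P → Q) → indicator p ≤ indicator q
    head (yes p) (yes _) f = ≤-refl
    head (yes p) (no ¬q) f = ⊥-elim (¬q (f p))
    head (no _)  _       f = z≤n

  count-cong : {P Q : A → Set} (P? : Decidable P) (Q? : Decidable Q) (T : List A) →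
               (∀ {t} → t ∈ T → P t → Q t) → (∀ {t} → t ∈ T → Q t → P t) →
               count P? T ≡ count Q? T
  count-cong P? Q? T to from = ≤-antisym (count-mono P? Q? T to) (count-mono Q? P? T from)

  count-none : {P : A → Set} (P? : Decidable P) (T : List A) →
               (∀ {t} → t ∈ T → ¬ P t) → count P? T ≡ 0
  count-none P? []      none = refl
  count-none P? (t ∷ T) none with P? t
  ... | yes p = ⊥-elim (none (here refl) p)
  ... | no  _ = count-none P? T (none ∘ there)

  count-positive : {P : A → Set} (P? : Decidable P) (T : List A) →
                   ∀ {t} → t ∈ T → P t → 1 ≤ count P? T
  count-positive P? (t ∷ T) (here refl) p with P? t
  ... | yes _ = s≤s z≤n
  ... | no ¬p = ⊥-elim (¬p p)
  count-positive P? (t ∷ T) (there m) p =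
    ≤-trans (count-positive P? T m p) (m≤n+m _ (indicator (P? t)))

  count-zero-or-witness : {P : A → Set} (P? : Decidable P) (T : List A) →
                          count P? T ≡ 0 ⊎ ∃[ t ] t ∈ T × P t
  count-zero-or-witness P? []      = inj₁ refl
  count-zero-or-witness P? (t ∷ T) with P? t
  ... | yes p = inj₂ (t , here refl , p)
  ... | no  _ with count-zero-or-witness P? T
  ...   | inj₁ none         = inj₁ none
  ...   | inj₂ (u , m , p) = inj₂ (u , there m , p)

  count-unique : {P : A → Set} (P? : Decidable P) (T : List A) → Unique T →
                 ∀ {t₀} → t₀ ∈ T → P t₀ → (∀ {t} → t ∈ T → P t → t ≡ t₀) → count P? T ≡ 1
  count-unique P? (t ∷ T) (t∉T ∷ _) (here refl) p only with P? t
  ... | yes _ = cong suc (count-none P? T (λ m q → All-lookup t∉T m (sym (only (there m) q))))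
  ... | no ¬p = ⊥-elim (¬p p)
  count-unique P? (t ∷ T) (t∉T ∷ uT) (there m) p only with P? t
  ... | yes q = ⊥-elim (All-lookup t∉T m (only (here refl) q))
  ... | no  _ = count-unique P? T uT m p (only ∘ there)

  count-reflect : {P Q : A → Set} (P? : Decidable P) (Q? : Decidable Q) (T : List A) →
                  (∀ {t} → t ∈ T → P t → Q t) → count P? T ≡ count Q? T →
                  ∀ {t} → t ∈ T → Q t → P t
  count-reflect {P} {Q} P? Q? (t ∷ T) sub eq m q with P? t | Q? t
  ... | yes p | no ¬q = ⊥-elim (¬q (sub (here refl) p))
  ... | yes p | yes _ = reflect-tail m q p (suc-injective eq)
    where
    reflect-tail : ∀ {u} → u ∈ t ∷ T → Q u → P t → count P? T ≡ count Q? T → P u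
    reflect-tail (here refl) _ p _  = p
    reflect-tail (there m)   q _ eq = count-reflect P? Q? T (sub ∘ there) eq m q
  ... | no ¬p | yes _ = ⊥-elim (≤⇒≯ (count-mono P? Q? T (sub ∘ there)) (≤-reflexive (sym eq)))
  ... | no ¬p | no ¬q = reflect-tail m q
    where
    reflect-tail : ∀ {u} → u ∈ t ∷ T → Q u → P u
    reflect-tail (here refl) q = ⊥-elim (¬q q)
    reflect-tail (there m)   q = count-reflect P? Q? T (sub ∘ there) eq m q

  count-by-fibres : {P Q : A → Set} {R : A → A → Set}
                    (P? : Decidable P) (Q? : Decidable Q) (R? : ∀ s t → Dec (R s t))
                    (S T : List A) →
                    (∀ {s} → s ∈ S → P s → count (λ t → Q? t ×-dec R? s t) T ≡ 1) →
                    count P? S ≡ sumOver T (λ t → count (λ s → Q? t ×-dec (P? s ×-dec R? s t)) S)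
  count-by-fibres P? Q? R? []      T partner =
    sym (trans (sumOver-indicator Q? T _ 0 (λ _ _ → refl) (λ _ _ → refl)) (*-zeroʳ (count Q? T)))
  count-by-fibres P? Q? R? (s ∷ S) T partner = begin
      indicator (P? s) + count P? S
    ≡⟨ cong₂ _+_ (sym (head (P? s) (partner (here refl)))) (count-by-fibres P? Q? R? S T (partner ∘ there)) ⟩
      sumOver T (λ t → indicator (Q? t ×-dec (P? s ×-dec R? s t))) + sumOver T (fibre S)
    ≡⟨ sym (sumOver-+ T _ (fibre S)) ⟩
      sumOver T (fibre (s ∷ S)) ∎
    where
    open ≡-Reasoning
    fibre : List A → A → ℕ
    fibre S t = count (λ s → Q? t ×-dec (P? s ×-dec R? s t)) S
    head : (d : Dec _) → (_ → count (λ t → Q? t ×-dec R? s t) T ≡ 1) →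
           count (λ t → Q? t ×-dec (d ×-dec R? s t)) T ≡ indicator d
    head (yes p) one = trans (count-cong _ _ T (λ _ (q , _ , r) → q , r) (λ _ (q , r) → q , p , r)) (one p)
    head (no ¬p) _   = count-none _ T (λ _ (_ , p , _) → ¬p p)

  count-by-equal-fibres : {P Q : A → Set} {R : A → A → Set}
                          (P? : Decidable P) (Q? : Decidable Q) (R? : ∀ s t → Dec (R s t))
                          (S T : List A) (c : ℕ) →
                          (∀ {s} → s ∈ S → P s → count (λ t → Q? t ×-dec R? s t) T ≡ 1) →
                          (∀ {t} → t ∈ T → Q t → count (λ s → P? s ×-dec R? s t) S ≡ c) →
                          count P? S ≡ count Q? T * c
  count-by-equal-fibres P? Q? R? S T c partner fibre =
    trans (count-by-fibres P? Q? R? S T partner)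
          (sumOver-indicator Q? T _ c
            (λ m q → trans (count-cong _ _ S (λ _ → proj₂) (λ _ pr → q , pr)) (fibre m q))
            (λ _ ¬q → count-none _ S (λ _ qpr → ¬q (proj₁ qpr))))

open Counting

-- Agreement of assignments on a tuple of variables

module _ {N k : ℕ} where

  record Agree (vs : Tuple k) (a b : Vec (Fin N) k) : Set where
    constructor agree
    field at : ∀ {i} → i ∈ vs → lookup a i ≡ lookup b i
  open Agree public

  agree-refl : ∀ {vs a} → Agree vs a a
  agree-refl = agree λ _ → refl

  agree-sym : ∀ {vs a b} → Agree vs a b → Agree vs b a
  agree-sym p = agree (sym ∘ at p)

  agree-trans : ∀ {vs a b c} → Agree vs a b → Agree vs b c → Agree vs a c
  agree-trans p q = agree λ m → trans (at p m) (at q m)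

  agree-⊆ : ∀ {us vs a b} → (∀ {i} → i ∈ us → i ∈ vs) → Agree vs a b → Agree us a b
  agree-⊆ sub p = agree (at p ∘ sub)

  agree-∪ : ∀ {us vs ws a b} → (∀ {i} → i ∈ ws → i ∈ us ⊎ i ∈ vs) →
            Agree us a b → Agree vs a b → Agree ws a b
  agree-∪ cov p q = agree λ m → [ at p , at q ] (cov m)

  agree-all : ∀ {vs a b} → (∀ i → i ∈ vs) → Agree vs a b → a ≡ b
  agree-all {a = a} {b} all p = begin
      a                ≡⟨ sym (tabulate∘lookup a) ⟩
      tabulate (lookup a) ≡⟨ tabulate-cong (λ i → at p (all i)) ⟩
      tabulate (lookup b) ≡⟨ tabulate∘lookup b ⟩
      b                ∎
    where open ≡-Reasoning

  ⟦⟧⇒agree : ∀ vs {a b} → a ⟦ vs ⟧ ≡ b ⟦ vs ⟧ → Agree vs a b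
  ⟦⟧⇒agree []       eq = agree λ ()
  ⟦⟧⇒agree (v ∷ vs) {a} {b} eq = agree λ where
    (here refl) → proj₁ (∷-injective eq)
    (there m)   → at (⟦⟧⇒agree vs {a} {b} (proj₂ (∷-injective eq))) m

  agree⇒⟦⟧ : ∀ vs {a b} → Agree vs a b → a ⟦ vs ⟧ ≡ b ⟦ vs ⟧
  agree⇒⟦⟧ []       p = refl
  agree⇒⟦⟧ (v ∷ vs) p = cong₂ _∷_ (at p (here refl)) (agree⇒⟦⟧ vs (agree-⊆ there p))

  agree? : ∀ vs a b → Dec (Agree vs a b)
  agree? vs a b = map′ (⟦⟧⇒agree vs) (agree⇒⟦⟧ vs) (≡-dec _≟ᶠ_ (a ⟦ vs ⟧) (b ⟦ vs ⟧))

-- The two independence notions for a set X of assignments, in counting form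

module Independence {N k : ℕ} (X : List (Vec (Fin N) k)) (X-unique : Unique X)
                    (xs ys zs : Tuple k) (cover : ∀ v → v ∈ xs ++ ys ++ zs) where

  open DecMembership (_≟ᶠ_ {k}) using (_∈?_)

  Val : Set
  Val = Vec (Fin N) k

  xy xz xyz : Tuple k
  xy  = xs ++ ys
  xz  = xs ++ zs
  xyz = xs ++ ys ++ zs

  size : Tuple k → Val → ℕ
  size vs t = count (λ s → agree? vs s t) X

  PCI : Set
  PCI = ∀ t → size xy t * size xz t ≡ size xyz t * size xs t

  CI : Set
  CI = ∀ {s s'} → s ∈ X → s' ∈ X → Agree xs s s' →
       ∃[ r ] r ∈ X × Agree xy r s × Agree xz r s'

  agree-x-y : ∀ {a b : Val} → Agree xs a b → Agree ys a b → Agree xy a b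
  agree-x-y = agree-∪ (∈-++⁻ xs)

  agree-x-z : ∀ {a b : Val} → Agree xs a b → Agree zs a b → Agree xz a b
  agree-x-z = agree-∪ (∈-++⁻ xs)

  agree-xy-x : ∀ {a b : Val} → Agree xy a b → Agree xs a b
  agree-xy-x = agree-⊆ ∈-++⁺ˡ

  agree-xy-y : ∀ {a b : Val} → Agree xy a b → Agree ys a b
  agree-xy-y = agree-⊆ (∈-++⁺ʳ xs)

  agree-xz-x : ∀ {a b : Val} → Agree xz a b → Agree xs a b
  agree-xz-x = agree-⊆ ∈-++⁺ˡ

  agree-xz-z : ∀ {a b : Val} → Agree xz a b → Agree zs a b
  agree-xz-z = agree-⊆ (∈-++⁺ʳ xs)

  agree-xy-z : ∀ {a b : Val} → Agree xy a b → Agree zs a b → Agree xyz a b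
  agree-xy-z = agree-∪ (λ m → [ inj₁ ∘ ∈-++⁺ˡ , [ inj₁ ∘ ∈-++⁺ʳ xs , inj₂ ] ∘ ∈-++⁻ ys ] (∈-++⁻ xs m))

  agree-xyz-xy : ∀ {a b : Val} → Agree xyz a b → Agree xy a b
  agree-xyz-xy = agree-⊆ (λ m → [ ∈-++⁺ˡ , ∈-++⁺ʳ xs ∘ ∈-++⁺ˡ ] (∈-++⁻ xs m))

  agree-xyz-xz : ∀ {a b : Val} → Agree xyz a b → Agree xz a b
  agree-xyz-xz = agree-⊆ (λ m → [ ∈-++⁺ˡ , ∈-++⁺ʳ xs ∘ ∈-++⁺ʳ ys ] (∈-++⁻ xs m))

  determined : ∀ {a b : Val} → Agree xyz a b → a ≡ b
  determined = agree-all cover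

  count-determined : {P : Val → Set} (P? : Decidable P) → ∀ {e} → e ∈ X → P e →
                     (∀ {r} → r ∈ X → P r → Agree xyz r e) → count P? X ≡ 1
  count-determined P? eX pe pins = count-unique P? X X-unique eX pe (λ rX pr → determined (pins rX pr))

  size-resp : ∀ vs {a b} → Agree vs a b → size vs a ≡ size vs b
  size-resp vs p = count-cong _ _ X (λ _ q → agree-trans q p) (λ _ q → agree-trans q (agree-sym p))

  size-positive : ∀ vs {s t} → s ∈ X → Agree vs s t → 1 ≤ size vs t
  size-positive vs sX p = count-positive (λ r → agree? vs r _) X sX p

  size-xyz-member : ∀ {e} → e ∈ X → size xyz e ≡ 1
  size-xyz-member eX = count-determined (λ r → agree? xyz r _) eX agree-refl (λ _ p → p)

  -- ⊥ implies ⫫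

  -- Under ⊥ all y⃗-rows of an x⃗-fibre have the same size: r ↦ the member
  -- with x⃗y⃗ of v and z⃗ of r is a bijection from the row of u to that of v.
  ci-rows-equal : CI → ∀ {u v} → u ∈ X → v ∈ X → Agree xs u v → size xy u ≡ size xy v
  ci-rows-equal ci {u} {v} uX vX uv = trans
    (count-by-equal-fibres (λ r → agree? xy r u) (λ r → agree? xy r v) (λ r r' → agree? zs r r')
                           X X 1 partner fibre)
    (*-identityʳ (size xy v))
    where
    partner : ∀ {r} → r ∈ X → Agree xy r u →
              count (λ r' → agree? xy r' v ×-dec agree? zs r r') X ≡ 1
    partner rX ru with ci vX rX (agree-trans (agree-sym uv) (agree-sym (agree-xy-x ru)))
    ... | r' , r'X , r'v , r'r =
      count-determined _ r'X (r'v , agree-sym (agree-xz-z r'r))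
        (λ _ (pv , rp) → agree-xy-z (agree-trans pv (agree-sym r'v))
                                   (agree-trans (agree-sym rp) (agree-sym (agree-xz-z r'r))))
    fibre : ∀ {r'} → r' ∈ X → Agree xy r' v →
            count (λ r → agree? xy r u ×-dec agree? zs r r') X ≡ 1
    fibre r'X r'v with ci uX r'X (agree-trans uv (agree-sym (agree-xy-x r'v)))
    ... | r , rX , ru , rr' =
      count-determined _ rX (ru , agree-xz-z rr')
        (λ _ (pu , pr') → agree-xy-z (agree-trans pu (agree-sym ru))
                                    (agree-trans pr' (agree-sym (agree-xz-z rr'))))

  ci-fibre-size : CI → ∀ {e} → e ∈ X → size xy e * size xz e ≡ size xs e
  ci-fibre-size ci {e} eX = trans (*-comm (size xy e) (size xz e)) (sym
    (count-by-equal-fibres (λ s → agree? xs s e) (λ u → agree? xz u e) (λ s u → agree? ys s u)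
                           X X (size xy e) partner fibre))
    where
    partner : ∀ {s} → s ∈ X → Agree xs s e → count (λ u → agree? xz u e ×-dec agree? ys s u) X ≡ 1
    partner sX se with ci sX eX se
    ... | r , rX , rs , re =
      count-determined _ rX (re , agree-sym (agree-xy-y rs))
        (λ _ (ue , su) → agree-xy-z (agree-x-y (agree-trans (agree-xz-x ue) (agree-sym (agree-xz-x re)))
                                               (agree-trans (agree-sym su) (agree-sym (agree-xy-y rs))))
                                    (agree-trans (agree-xz-z ue) (agree-sym (agree-xz-z re))))
    fibre : ∀ {u} → u ∈ X → Agree xz u e → count (λ s → agree? xs s e ×-dec agree? ys s u) X ≡ size xy e
    fibre {u} uX ue = begin
        count (λ s → agree? xs s e ×-dec agree? ys s u) X
      ≡⟨ count-cong _ _ X (λ _ (se , su) → agree-x-y (agree-trans se (agree-sym ux)) su)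
                          (λ _ su → agree-trans (agree-xy-x su) ux , agree-xy-y su) ⟩
        size xy u
      ≡⟨ ci-rows-equal ci uX eX ux ⟩
        size xy e ∎
      where
      open ≡-Reasoning
      ux = agree-xz-x ue

  ci-empty-class : CI → ∀ {t} → size xyz t ≡ 0 → size xy t * size xz t ≡ 0
  ci-empty-class ci {t} empty
    with count-zero-or-witness (λ r → agree? xy r t) X | count-zero-or-witness (λ r → agree? xz r t) X
  ... | inj₁ none-y | _          = cong (_* size xz t) none-y
  ... | inj₂ _      | inj₁ none-z = trans (cong (size xy t *_) none-z) (*-zeroʳ (size xy t))
  ... | inj₂ (u , uX , ut) | inj₂ (v , vX , vt)
    with ci uX vX (agree-trans (agree-xy-x ut) (agree-sym (agree-xz-x vt)))
  ...   | r , rX , ru , rv = ⊥-elim (≤⇒≯ (≤-reflexive empty) (size-positive xyz rX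
          (agree-xy-z (agree-trans ru ut) (agree-trans (agree-xz-z rv) (agree-xz-z vt)))))

  ci⇒pci : CI → PCI
  ci⇒pci ci t with count-zero-or-witness (λ r → agree? xyz r t) X
  ... | inj₁ empty = trans (ci-empty-class ci empty) (sym (cong (_* size xs t) empty))
  ... | inj₂ (e , eX , et) = begin
      size xy t * size xz t  ≡⟨ cong₂ _*_ (size-resp xy (agree-xyz-xy (agree-sym et)))
                                          (size-resp xz (agree-xyz-xz (agree-sym et))) ⟩
      size xy e * size xz e  ≡⟨ ci-fibre-size ci eX ⟩
      size xs e              ≡⟨ size-resp xs (agree-xy-x (agree-xyz-xy et)) ⟩
      size xs t              ≡⟨ sym (*-identityˡ (size xs t)) ⟩
      1 * size xs t          ≡⟨ cong (_* size xs t) (trans (sym (size-xyz-member eX)) (size-resp xyz et)) ⟩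
      size xyz t * size xs t ∎
    where open ≡-Reasoning

  -- ⫫ implies ⊥

  shared : Tuple k
  shared = filter (_∈? zs) ys

  agree-y-shared : ∀ {a b : Val} → Agree ys a b → Agree shared a b
  agree-y-shared = agree-⊆ (proj₁ ∘ ∈-filter⁻ (_∈? zs) {xs = ys})

  agree-z-shared : ∀ {a b : Val} → Agree zs a b → Agree shared a b
  agree-z-shared = agree-⊆ (proj₂ ∘ ∈-filter⁻ (_∈? zs) {xs = ys})

  merge : Val → Val → Val
  merge u v = tabulate (λ i → if does (i ∈? ys) then lookup u i else lookup v i)

  merge-xy : ∀ {u v} → Agree xs u v → Agree xy (merge u v) u
  merge-xy {u} {v} uv = agree λ {i} m → trans (lookup∘tabulate _ i) (pick i (i ∈? ys) (∈-++⁻ xs m))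
    where
    pick : ∀ i (d : Dec (i ∈ ys)) → i ∈ xs ⊎ i ∈ ys →
           (if does d then lookup u i else lookup v i) ≡ lookup u i
    pick i (yes _)  _         = refl
    pick i (no _)   (inj₁ ix) = sym (at uv ix)
    pick i (no ¬iy) (inj₂ iy) = ⊥-elim (¬iy iy)

  merge-xz : ∀ {u v} → Agree xs u v → Agree shared u v → Agree xz (merge u v) v
  merge-xz {u} {v} uv uv-shared = agree λ {i} m → trans (lookup∘tabulate _ i) (pick i (i ∈? ys) (∈-++⁻ xs m))
    where
    pick : ∀ i (d : Dec (i ∈ ys)) → i ∈ xs ⊎ i ∈ zs →
           (if does d then lookup u i else lookup v i) ≡ lookup v i
    pick i (yes _)  (inj₁ ix) = at uv ix
    pick i (yes iy) (inj₂ iz) = at uv-shared (∈-filter⁺ (_∈? zs) iy iz)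
    pick i (no _)   _         = refl

  pci-witness : PCI → ∀ {u v} → u ∈ X → v ∈ X → Agree xs u v → Agree shared u v →
                ∃[ e ] e ∈ X × Agree xy e u × Agree xz e v
  pci-witness pci {u} {v} uX vX uv uv-shared with count-zero-or-witness (λ r → agree? xyz r (merge u v)) X
  ... | inj₁ empty = ⊥-elim (n≮0 (subst (λ n → 1 ≤ n * size xs (merge u v)) empty positive))
    where
    positive : 1 ≤ size xyz (merge u v) * size xs (merge u v)
    positive = subst (1 ≤_) (pci (merge u v))
      (*-mono-≤ (size-positive xy uX (agree-sym (merge-xy uv)))
                (size-positive xz vX (agree-sym (merge-xz uv uv-shared))))
  ... | inj₂ (e , eX , et) =
    e , eX , agree-trans (agree-xyz-xy et) (merge-xy uv) , agree-trans (agree-xyz-xz et) (merge-xz uv uv-shared)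

  pci-fibre-size : PCI → ∀ {e} → e ∈ X → size xy e * size xz e ≡ size xs e
  pci-fibre-size pci {e} eX =
    trans (pci e) (trans (cong (_* size xs e) (size-xyz-member eX)) (*-identityˡ (size xs e)))

  pci-rows-equal : PCI → ∀ {u s} → u ∈ X → s ∈ X → Agree xz u s → size xy u ≡ size xy s
  pci-rows-equal pci {u} {s} uX sX us =
    *-cancelʳ-≡ (size xy u) (size xy s) (size xz s) {{>-nonZero (size-positive xz sX agree-refl)}} (begin
      size xy u * size xz s  ≡⟨ cong (size xy u *_) (sym (size-resp xz us)) ⟩
      size xy u * size xz u  ≡⟨ pci-fibre-size pci uX ⟩
      size xs u              ≡⟨ size-resp xs (agree-xz-x us) ⟩
      size xs s              ≡⟨ sym (pci-fibre-size pci sX) ⟩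
      size xy s * size xz s  ∎)
    where open ≡-Reasoning

  -- Under ⫫, an x⃗-fibre is constant on the variables shared by y⃗ and z⃗:
  -- its members agreeing with s there are counted as the whole fibre.
  pci-shared : PCI → ∀ {s s'} → s ∈ X → s' ∈ X → Agree xs s s' → Agree shared s s'
  pci-shared pci {s} {s'} sX s'X ss' = agree-sym
    (proj₂ (count-reflect compatible? (λ r → agree? xs r s) X (λ _ → proj₁) same-count s'X (agree-sym ss')))
    where
    open ≡-Reasoning
    compatible? : Decidable (λ r → Agree xs r s × Agree shared r s)
    compatible? r = agree? xs r s ×-dec agree? shared r s
    partner : ∀ {r} → r ∈ X → Agree xs r s × Agree shared r s →
              count (λ u → agree? xz u s ×-dec agree? ys r u) X ≡ 1
    partner rX (rs , rs-shared) with pci-witness pci rX sX rs rs-shared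
    ... | e , eX , er , es =
      count-determined _ eX (es , agree-sym (agree-xy-y er))
        (λ _ (us , ru) → agree-xy-z (agree-x-y (agree-trans (agree-xz-x us) (agree-sym (agree-xz-x es)))
                                               (agree-trans (agree-sym ru) (agree-sym (agree-xy-y er))))
                                    (agree-trans (agree-xz-z us) (agree-sym (agree-xz-z es))))
    fibre : ∀ {u} → u ∈ X → Agree xz u s →
            count (λ r → compatible? r ×-dec agree? ys r u) X ≡ size xy s
    fibre {u} uX us = begin
        count (λ r → compatible? r ×-dec agree? ys r u) X
      ≡⟨ count-cong _ _ X
           (λ _ ((rs , _) , ru) → agree-x-y (agree-trans rs (agree-sym (agree-xz-x us))) ru)
           (λ _ ru → (agree-trans (agree-xy-x ru) (agree-xz-x us)
                     , agree-trans (agree-y-shared (agree-xy-y ru)) (agree-z-shared (agree-xz-z us)))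
                     , agree-xy-y ru) ⟩
        size xy u
      ≡⟨ pci-rows-equal pci uX sX us ⟩
        size xy s ∎
    same-count : count compatible? X ≡ size xs s
    same-count = begin
        count compatible? X
      ≡⟨ count-by-equal-fibres compatible? (λ u → agree? xz u s) (λ r u → agree? ys r u)
                               X X (size xy s) partner fibre ⟩
        size xz s * size xy s
      ≡⟨ *-comm (size xz s) (size xy s) ⟩
        size xy s * size xz s
      ≡⟨ pci-fibre-size pci sX ⟩
        size xs s ∎

  pci⇒ci : PCI → CI
  pci⇒ci pci sX s'X ss' = pci-witness pci sX s'X ss' (pci-shared pci sX s'X ss')

module Semantics (𝔄 : MultiStructure) {k : ℕ} (X : Team k (Carrier 𝔄))
                 (xs ys zs : Tuple k) (cover : ∀ v → v ∈ xs ++ ys ++ zs) where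

  open Independence {N = MultiStructure.size 𝔄} (Team.elems X) (Team.unique X) xs ys zs cover

  restrictSize-one : ∀ (L : List Val) vs t → restrictSize L one vs (t ⟦ vs ⟧) ≡ count (λ s → agree? vs s t) L
  restrictSize-one []      vs t = refl
  restrictSize-one (s ∷ L) vs t with ≡-dec _≟ᶠ_ (s ⟦ vs ⟧) (t ⟦ vs ⟧)
  ... | yes _ = cong suc (restrictSize-one L vs t)
  ... | no  _ = restrictSize-one L vs t

  pci⇔ : PCondIndep 𝔄 X one xs ys zs ⇔ PCI
  pci⇔ = mk⇔ (λ p t → trans (sym (cong₂ _*_ (rs xy t) (rs xz t))) (trans (p t) (cong₂ _*_ (rs xyz t) (rs xs t))))
             (λ p t → trans (cong₂ _*_ (rs xy t) (rs xz t)) (trans (p t) (sym (cong₂ _*_ (rs xyz t) (rs xs t)))))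
    where
    rs : ∀ vs t → restrictSize (Team.elems X) one vs (t ⟦ vs ⟧) ≡ size vs t
    rs = restrictSize-one (Team.elems X)

  -- ⊥ is the agreement statement CI (every multiplicity is 1, so X⁺ = X).
  ci⇔ : CondIndep 𝔄 X one xs ys zs ⇔ CI
  ci⇔ = mk⇔ to from
    where
    to : CondIndep 𝔄 X one xs ys zs → CI
    to c {s} {s'} sX s'X ss' with c s s' (sX , s≤s z≤n) (s'X , s≤s z≤n) (agree⇒⟦⟧ xs ss')
    ... | r , (rX , _) , rx , ry , rz =
      r , rX , agree-x-y (⟦⟧⇒agree xs rx) (⟦⟧⇒agree ys ry)
             , agree-x-z (agree-trans (⟦⟧⇒agree xs rx) ss') (⟦⟧⇒agree zs rz)
    from : CI → CondIndep 𝔄 X one xs ys zs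
    from c s s' (sX , _) (s'X , _) ss' with c sX s'X (⟦⟧⇒agree xs ss')
    ... | r , rX , rs , rs' =
      r , (rX , s≤s z≤n) , agree⇒⟦⟧ xs (agree-xy-x rs) , agree⇒⟦⟧ ys (agree-xy-y rs)
        , agree⇒⟦⟧ zs (agree-xz-z rs')

proposition4 : (𝔄 : MultiStructure) (k : ℕ) (X : Team k (Carrier 𝔄))
               (xs ys zs : Tuple k) →
               ((v : Fin k) → v ∈ xs ++ ys ++ zs) →
               PCondIndep 𝔄 X one xs ys zs ⇔ CondIndep 𝔄 X one xs ys zs
proposition4 𝔄 k X xs ys zs cover =
  mk⇔ (from ci⇔ ∘ pci⇒ci ∘ to pci⇔)
      (from pci⇔ ∘ ci⇒pci ∘ to ci⇔)
  where
  open Semantics 𝔄 X xs ys zs cover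
  open Independence {N = MultiStructure.size 𝔄} (Team.elems X) (Team.unique X) xs ys zs cover
  open Equivalence
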